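{- Every family of equivalence structures that is $\mathbf{Inf}\mathbf{Ex}_{\cong}$-learnable is $\mathbf{Inf}\mathbf{Ex}_{\approx}$-learnable, and the inclusion is strict: there is a family of equivalence structures that is $\mathbf{Inf}\mathbf{Ex}_{\approx}$-learnable but not $\mathbf{Inf}\mathbf{Ex}_{\cong}$-learnable.
   Context: An equivalence structure is $\mathcal{A}=(\omega,E)$ with $E$ an equivalence relation on $\omega$; an $\omega$-presentation of $\mathcal{M}$ is an equivalence structure with domain $\omega$ isomorphic to $\mathcal{M}$. Fix a computable sequence $(E_i)_{i\in\omega}$ of equivalence relations on $\omega$ such that every infinite computable equivalence structure is isomorphic to some $\mathcal{M}_i=(\omega,E_i)$; a conjecture $e$ denotes $\mathcal{M}_e$. An informant for $\mathcal{A}=(\omega,E)$ is $I:\omega\to\omega^2\times\{0,1\}$ such that for each $(x,y)$ exactly one of $((x,y),0),((x,y),1)$ is in the range of $I$ and $\{(x,y):((x,y),1)\in\mathrm{range}(I)\}=E$; $I[n]=I(0),\dots,I(n-1)$. A learner is an arbitrary function from finite sequences to $\omega\cup\{?\}$. For an equivalence relation $\sim$ on structures, $\mathfrak{A}$ is $\mathbf{Inf}\mathbf{Ex}_{\sim}$-learnable if there is a learner $M$ such that for every $\mathcal{A}\in\mathfrak{A}$, every $\omega$-presentation $\mathcal{A}^*$ of $\mathcal{A}$ and every informant $I$ for $\mathcal{A}^*$ there is $e$ with $M(I[n])=e$ for all but finitely many $n$ and $\mathcal{A}^*\sim\mathcal{M}_e$. Here $\cong$ is isomorphism and $\approx$ is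 bi-embeddability: $\mathcal{A}\approx\mathcal{B}$ iff each embeds into the other, where $\mathcal{A}\hookrightarrow\mathcal{B}$ means there is an injection $f$ with $xE_{\mathcal{A}}y\Leftrightarrow f(x)E_{\mathcal{B}}f(y)$. -}

module Defs where

open import Data.Nat using (ℕ; zero; suc; _≤_)
open import Data.Fin using (Fin)
open import Data.Vec using (Vec; []; _∷_; lookup)
open import Data.Bool using (Bool; true; false)
open import Data.Maybe using (Maybe; just)
open import Data.List using (List)
import Data.List as List
open import Data.Product using (Σ; _×_; _,_; ∃)
open import Data.Sum using (_⊎_)
open import Relation.Nullary using (¬_)
open import Relation.Binary.PropositionalEquality using (_≡_)
open import Function using (_⇔_)

data Code : ℕ → Set where
  czero : ∀ {n} → Code n
  csucc : Code 1
  cproj : ∀ {n} → Fin n → Code n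
  ccomp : ∀ {m n} → Code m → Vec (Code n) m → Code n
  cprec : ∀ {n} → Code n → Code (suc (suc n)) → Code (suc n)
  cmu   : ∀ {n} → Code (suc n) → Code n

mutual
  data _[_]⇓_ : ∀ {n} → Code n → Vec ℕ n → ℕ → Set where
    ev-zero : ∀ {n} {xs : Vec ℕ n} → czero [ xs ]⇓ 0
    ev-succ : ∀ {x} → csucc [ x ∷ [] ]⇓ suc x
    ev-proj : ∀ {n} {i : Fin n} {xs} → cproj i [ xs ]⇓ lookup xs i
    ev-comp : ∀ {m n} {f : Code m} {gs : Vec (Code n) m} {xs ys v} →
              gs [ xs ]⇓* ys → f [ ys ]⇓ v → ccomp f gs [ xs ]⇓ v
    ev-prec-zero : ∀ {n} {f : Code n} {g} {xs v} →
              f [ xs ]⇓ v → cprec f g [ 0 ∷ xs ]⇓ v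
    ev-prec-suc : ∀ {n} {f : Code n} {g} {k xs u v} →
              cprec f g [ k ∷ xs ]⇓ u → g [ k ∷ u ∷ xs ]⇓ v →
              cprec f g [ suc k ∷ xs ]⇓ v
    ev-mu : ∀ {n} {f : Code (suc n)} {xs y} →
              Search f xs 0 y → cmu f [ xs ]⇓ y

  data _[_]⇓*_ : ∀ {m n} → Vec (Code n) m → Vec ℕ n → Vec ℕ m → Set where
    ev-[] : ∀ {n} {xs : Vec ℕ n} → [] [ xs ]⇓* []
    ev-∷  : ∀ {m n} {g : Code n} {gs : Vec (Code n) m} {xs y ys} →
            g [ xs ]⇓ y → gs [ xs ]⇓* ys → (g ∷ gs) [ xs ]⇓* (y ∷ ys)

  data Search : ∀ {n} → Code (suc n) → Vec ℕ n → ℕ → ℕ → Set where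
    found : ∀ {n} {f : Code (suc n)} {xs z} →
            f [ z ∷ xs ]⇓ 0 → Search f xs z z
    next  : ∀ {n} {f : Code (suc n)} {xs z k y} →
            f [ z ∷ xs ]⇓ suc k → Search f xs (suc z) y → Search f xs z y

χ : Bool → ℕ
χ true  = 1
χ false = 0

Rel : Set
Rel = ℕ → ℕ → Bool

ComputableRel : Rel → Set
ComputableRel R = Σ (Code 2) λ c → ∀ x y → c [ x ∷ y ∷ [] ]⇓ χ (R x y)

ComputableSeq : (ℕ → Rel) → Set
ComputableSeq E = Σ (Code 3) λ c → ∀ i x y → c [ i ∷ x ∷ y ∷ [] ]⇓ χ (E i x y)

record IsEquivRel (R : Rel) : Set where
  field
    refl  : ∀ x → R x x ≡ true
    sym   : ∀ x y → R x y ≡ true → R y x ≡ true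
    trans : ∀ x y z → R x y ≡ true → R y z ≡ true → R x z ≡ true

record EqStr : Set where
  field
    rel     : Rel
    isEquiv : IsEquivRel rel
open EqStr public

_≅_ : Rel → Rel → Set
R ≅ S = Σ (ℕ → ℕ) λ f → Σ (ℕ → ℕ) λ g →
          (∀ x → g (f x) ≡ x) × (∀ y → f (g y) ≡ y) × (∀ x y → R x y ≡ S (f x) (f y))

_↪_ : Rel → Rel → Set
R ↪ S = Σ (ℕ → ℕ) λ f →
          (∀ x y → f x ≡ f y → x ≡ y) × (∀ x y → R x y ≡ S (f x) (f y))

_≈ᵇ_ : Rel → Rel → Set
R ≈ᵇ S = (R ↪ S) × (S ↪ R)

Datum : Set
Datum = (ℕ × ℕ) × Bool

InRange : (ℕ → Datum) → Datum → Set
InRange I d = ∃ λ n → I n ≡ d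

IsInformant : Rel → (ℕ → Datum) → Set
IsInformant E I =
  (∀ x y → (InRange I ((x , y) , false) × ¬ InRange I ((x , y) , true))
         ⊎ (InRange I ((x , y) , true) × ¬ InRange I ((x , y) , false)))
  × (∀ x y → InRange I ((x , y) , true) ⇔ (E x y ≡ true))

_[_] : (ℕ → Datum) → ℕ → List Datum
I [ n ] = List.map I (List.upTo n)

-- a learner: arbitrary function from finite sequences to ω ∪ {?}
-- (? is represented by nothing)
Learner : Set
Learner = List Datum → Maybe ℕ

InfExLearnable : (ℕ → Rel) → (Rel → Rel → Set) → (EqStr → Set) → Set
InfExLearnable E _∼_ 𝔄 =
  Σ Learner λ M →
    ∀ (A : EqStr) → 𝔄 A →
    ∀ (A* : EqStr) → rel A* ≅ rel A →
    ∀ (I : ℕ → Datum) → IsInformant (rel A*) I →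
    Σ ℕ λ e → (Σ ℕ λ N → ∀ n → N ≤ n → M (I [ n ]) ≡ just e)
              × (rel A* ∼ E e)

-- The structures bi-embeddable with Columns (ω classes, each of size ω) are exactly
-- those with infinitely many infinite classes; the constant learner conjecturing an
-- index of Columns learns them up to bi-embeddability. Let Spliced l be Columns with its first column replaced by the classes
-- of a labelling l. Against a learner that succeeded, build labellings that
-- alternately contain no singleton class (paired) and exactly one (lonely), each
-- extending the previous one beyond the point where the learner has settled on it.
-- On the limit labelling the learner settles at some stage k; since the limit agrees
-- with paired k and lonely k beyond their settling points, the learner gives all three
-- the same conjecture, making paired k and lonely k isomorphic, which is impossible.

module Submission where

open import Defs
open import Data.Nat
open import Data.Nat.Properties
open import Data.Fin using () renaming (zero to #0; suc to #s)
open import Data.Vec using ([]; _∷_)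
open import Data.Bool using (true; false; T; if_then_else_)
open import Data.Unit using (tt)
open import Data.Product using (Σ; _×_; _,_; proj₁; proj₂)
open import Data.Sum using (_⊎_; inj₁; inj₂)
open import Data.Maybe using (just)
open import Data.Maybe.Properties using (just-injective)
open import Data.List.Properties using (map-cong-local)
open import Data.List.Relation.Unary.All.Properties using (applyUpTo⁺₁)
open import Data.Empty using (⊥)
open import Function using (_⇔_; mk⇔; _∘_; id; case_of_)
open import Relation.Binary.PropositionalEquality hiding ([_])
open import Relation.Nullary using (¬_; does; yes; no; contradiction)
open import Relation.Binary using (tri<; tri≈; tri>)
open import Relation.Nullary.Decidable using (dec-true; dec-false; does-⇔)

triangle : ℕ → ℕ
triangle zero    = 0
triangle (suc n) = triangle n + suc n

pair : ℕ → ℕ → ℕ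
pair i j = triangle (i + j) + i

-- diagonal (pair i j) = i + j, by primitive recursion so that it is computed by a Code.
diagonal : ℕ → ℕ
diagonal zero    = 0
diagonal (suc k) = diagonal k + χ (does (k ∸ triangle (diagonal k) ≟ diagonal k))

unpair₁ : ℕ → ℕ
unpair₁ k = k ∸ triangle (diagonal k)

unpair₂ : ℕ → ℕ
unpair₂ k = diagonal k ∸ unpair₁ k

diagonal-suc : ∀ n i → diagonal (triangle n + i) ≡ n →
               diagonal (suc (triangle n + i)) ≡ n + χ (does (i ≟ n))
diagonal-suc n i diagonal≡n rewrite diagonal≡n | m+n∸m≡n (triangle n) i = refl

diagonal-triangle : ∀ n i → i ≤ n → diagonal (triangle n + i) ≡ n
diagonal-triangle zero    zero    _   = refl
diagonal-triangle (suc n) zero    _   = begin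
  diagonal (triangle n + suc n + 0)  ≡⟨ cong diagonal (trans (+-identityʳ _) (+-suc (triangle n) n)) ⟩
  diagonal (suc (triangle n + n))    ≡⟨ diagonal-suc n n (diagonal-triangle n n ≤-refl) ⟩
  n + χ (does (n ≟ n))               ≡⟨ cong (λ b → n + χ b) (dec-true (n ≟ n) refl) ⟩
  n + 1                              ≡⟨ +-comm n 1 ⟩
  suc n                              ∎
  where open ≡-Reasoning
diagonal-triangle n (suc i) i<n = begin
  diagonal (triangle n + suc i)      ≡⟨ cong diagonal (+-suc (triangle n) i) ⟩
  diagonal (suc (triangle n + i))    ≡⟨ diagonal-suc n i (diagonal-triangle n i (<⇒≤ i<n)) ⟩
  n + χ (does (i ≟ n))               ≡⟨ cong (λ b → n + χ b) (dec-false (i ≟ n) (<⇒≢ i<n)) ⟩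
  n + 0                              ≡⟨ +-identityʳ n ⟩
  n                                  ∎
  where open ≡-Reasoning

unpair₁-pair : ∀ i j → unpair₁ (pair i j) ≡ i
unpair₁-pair i j rewrite diagonal-triangle (i + j) i (m≤m+n i j) = m+n∸m≡n (triangle (i + j)) i

unpair₂-pair : ∀ i j → unpair₂ (pair i j) ≡ j
unpair₂-pair i j rewrite unpair₁-pair i j | diagonal-triangle (i + j) i (m≤m+n i j) = m+n∸m≡n i j

pair-injective : ∀ {i j i′ j′} → pair i j ≡ pair i′ j′ → i ≡ i′ × j ≡ j′
pair-injective {i} {j} {i′} {j′} eq =
  trans (sym (unpair₁-pair i j)) (trans (cong unpair₁ eq) (unpair₁-pair i′ j′)) ,
  trans (sym (unpair₂-pair i j)) (trans (cong unpair₂ eq) (unpair₂-pair i′ j′))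

suc-pair-zero : ∀ i → suc (pair i 0) ≡ pair 0 (suc i)
suc-pair-zero i = begin
  suc (triangle (i + 0) + i)  ≡⟨ cong (λ m → suc (triangle m + i)) (+-identityʳ i) ⟩
  suc (triangle i + i)        ≡⟨ sym (+-suc (triangle i) i) ⟩
  triangle i + suc i          ≡⟨ sym (+-identityʳ _) ⟩
  triangle i + suc i + 0      ∎
  where open ≡-Reasoning

suc-pair-suc : ∀ i j → suc (pair i (suc j)) ≡ pair (suc i) j
suc-pair-suc i j = begin
  suc (triangle (i + suc j) + i)  ≡⟨ sym (+-suc (triangle (i + suc j)) i) ⟩
  triangle (i + suc j) + suc i    ≡⟨ cong (λ m → triangle m + suc i) (+-suc i j) ⟩
  triangle (suc (i + j)) + suc i  ∎
  where open ≡-Reasoning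

pair-surjective : ∀ k → Σ ℕ λ i → Σ ℕ λ j → pair i j ≡ k
pair-surjective zero = 0 , 0 , refl
pair-surjective (suc k) with pair-surjective k
... | i , zero  , refl = 0 , suc i , sym (suc-pair-zero i)
... | i , suc j , refl = suc i , j , sym (suc-pair-suc i j)

pair-unpair : ∀ k → pair (unpair₁ k) (unpair₂ k) ≡ k
pair-unpair k with pair-surjective k
... | i , j , refl = cong₂ pair (unpair₁-pair i j) (unpair₂-pair i j)

diagonal-≤ : ∀ k → diagonal k ≤ k
diagonal-≤ zero    = z≤n
diagonal-≤ (suc k) = ≤-trans (+-mono-≤ (diagonal-≤ k) (χ≤1 _)) (≤-reflexive (+-comm k 1))
  where
    χ≤1 : ∀ b → χ b ≤ 1
    χ≤1 true  = ≤-refl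
    χ≤1 false = z≤n

unpair₁-≤ : ∀ k → unpair₁ k ≤ k
unpair₁-≤ k = m∸n≤m k (triangle (diagonal k))

unpair₂-≤ : ∀ k → unpair₂ k ≤ k
unpair₂-≤ k = ≤-trans (m∸n≤m (diagonal k) (unpair₁ k)) (diagonal-≤ k)

comp₁ : ∀ {n} → Code 1 → Code n → Code n
comp₁ f g = ccomp f (g ∷ [])

comp₂ : ∀ {n} → Code 2 → Code n → Code n → Code n
comp₂ f g h = ccomp f (g ∷ h ∷ [])

⇓-comp₁ : ∀ {n} {f : Code 1} {g : Code n} {xs y v} →
          g [ xs ]⇓ y → f [ y ∷ [] ]⇓ v → comp₁ f g [ xs ]⇓ v
⇓-comp₁ g⇓ f⇓ = ev-comp (ev-∷ g⇓ ev-[]) f⇓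

⇓-comp₂ : ∀ {n} {f : Code 2} {g h : Code n} {xs y z v} →
          g [ xs ]⇓ y → h [ xs ]⇓ z → f [ y ∷ z ∷ [] ]⇓ v → comp₂ f g h [ xs ]⇓ v
⇓-comp₂ g⇓ h⇓ f⇓ = ev-comp (ev-∷ g⇓ (ev-∷ h⇓ ev-[])) f⇓

arg₀ : ∀ {n} → Code (suc n)
arg₀ = cproj #0

arg₁ : ∀ {n} → Code (suc (suc n))
arg₁ = cproj (#s #0)

addCode : Code 2
addCode = cprec arg₀ (comp₁ csucc arg₁)

⇓-add : ∀ k y → addCode [ k ∷ y ∷ [] ]⇓ (k + y)
⇓-add zero    y = ev-prec-zero ev-proj
⇓-add (suc k) y = ev-prec-suc (⇓-add k y) (⇓-comp₁ ev-proj ev-succ)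

predCode : Code 1
predCode = cprec czero arg₀

⇓-pred : ∀ k → predCode [ k ∷ [] ]⇓ pred k
⇓-pred zero    = ev-prec-zero ev-zero
⇓-pred (suc k) = ev-prec-suc (⇓-pred k) ev-proj

monusCode : Code 2
monusCode = cprec arg₀ (comp₁ predCode arg₁)

⇓-monus : ∀ k y → monusCode [ k ∷ y ∷ [] ]⇓ (y ∸ k)
⇓-monus zero    y = ev-prec-zero ev-proj
⇓-monus (suc k) y = subst (monusCode [ suc k ∷ y ∷ [] ]⇓_) (pred[m∸n]≡m∸[1+n] y k)
  (ev-prec-suc (⇓-monus k y) (⇓-comp₁ ev-proj (⇓-pred (y ∸ k))))

isZeroCode : Code 1
isZeroCode = cprec (comp₁ csucc czero) czero

⇓-isZero : ∀ k → isZeroCode [ k ∷ [] ]⇓ χ (does (k ≟ 0))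
⇓-isZero zero    = ev-prec-zero (⇓-comp₁ ev-zero ev-succ)
⇓-isZero (suc k) = ev-prec-suc (⇓-isZero k) ev-zero

distance-zero : ∀ a b → does ((a ∸ b) + (b ∸ a) ≟ 0) ≡ does (a ≟ b)
distance-zero zero    zero    = refl
distance-zero zero    (suc b) = refl
distance-zero (suc a) zero    = refl
distance-zero (suc a) (suc b) = distance-zero a b

eqCode : Code 2
eqCode = comp₁ isZeroCode (comp₂ addCode (comp₂ monusCode arg₁ arg₀) (comp₂ monusCode arg₀ arg₁))

⇓-eq : ∀ a b → eqCode [ a ∷ b ∷ [] ]⇓ χ (does (a ≟ b))
⇓-eq a b = subst (λ d → eqCode [ a ∷ b ∷ [] ]⇓ χ d) (distance-zero a b)
  (⇓-comp₁ (⇓-comp₂ (⇓-comp₂ ev-proj ev-proj (⇓-monus b a))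
                    (⇓-comp₂ ev-proj ev-proj (⇓-monus a b))
                    (⇓-add (a ∸ b) (b ∸ a)))
           (⇓-isZero _))

triangleCode : Code 1
triangleCode = cprec czero (comp₂ addCode arg₁ (comp₁ csucc arg₀))

⇓-triangle : ∀ k → triangleCode [ k ∷ [] ]⇓ triangle k
⇓-triangle zero    = ev-prec-zero ev-zero
⇓-triangle (suc k) = ev-prec-suc (⇓-triangle k)
  (⇓-comp₂ ev-proj (⇓-comp₁ ev-proj ev-succ) (⇓-add (triangle k) (suc k)))

diagonalCode : Code 1
diagonalCode = cprec czero
  (comp₂ addCode arg₁ (comp₂ eqCode (comp₂ monusCode (comp₁ triangleCode arg₁) arg₀) arg₁))

⇓-diagonal : ∀ k → diagonalCode [ k ∷ [] ]⇓ diagonal k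
⇓-diagonal zero    = ev-prec-zero ev-zero
⇓-diagonal (suc k) = ev-prec-suc (⇓-diagonal k)
  (⇓-comp₂ ev-proj
           (⇓-comp₂ (⇓-comp₂ (⇓-comp₁ ev-proj (⇓-triangle (diagonal k))) ev-proj
                             (⇓-monus (triangle (diagonal k)) k))
                    ev-proj
                    (⇓-eq (k ∸ triangle (diagonal k)) (diagonal k)))
           (⇓-add (diagonal k) _))

unpair₁Code : Code 1
unpair₁Code = comp₂ monusCode (comp₁ triangleCode diagonalCode) arg₀

⇓-unpair₁ : ∀ k → unpair₁Code [ k ∷ [] ]⇓ unpair₁ k
⇓-unpair₁ k = ⇓-comp₂ (⇓-comp₁ (⇓-diagonal k) (⇓-triangle (diagonal k))) ev-proj
                      (⇓-monus (triangle (diagonal k)) k)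

ker : (ℕ → ℕ) → Rel
ker L x y = does (L x ≟ L y)

ker-sound : ∀ L x y → ker L x y ≡ true → L x ≡ L y
ker-sound L x y related = ≡ᵇ⇒≡ (L x) (L y) (subst T (sym related) tt)

ker-complete : ∀ L x y → L x ≡ L y → ker L x y ≡ true
ker-complete L x y = dec-true (L x ≟ L y)

ker-isEquivRel : ∀ L → IsEquivRel (ker L)
ker-isEquivRel L = record
  { refl  = λ x → ker-complete L x x refl
  ; sym   = λ x y xy → ker-complete L y x (sym (ker-sound L x y xy))
  ; trans = λ x y z xy yz → ker-complete L x z (trans (ker-sound L x y xy) (ker-sound L y z yz))
  }

ker-↪ : ∀ {L L′} (f : ℕ → ℕ) → (∀ x y → f x ≡ f y → x ≡ y) →
        (∀ x y → L x ≡ L y ⇔ L′ (f x) ≡ L′ (f y)) → ker L ↪ ker L′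
ker-↪ {L} {L′} f f-injective same = f , f-injective ,
  λ x y → does-⇔ (same x y) (L x ≟ L y) (L′ (f x) ≟ L′ (f y))

Columns : Rel
Columns = ker unpair₁

Columns-computable : ComputableRel Columns
Columns-computable = comp₂ eqCode (comp₁ unpair₁Code arg₀) (comp₁ unpair₁Code arg₁) ,
  λ x y → ⇓-comp₂ (⇓-comp₁ ev-proj (⇓-unpair₁ x)) (⇓-comp₁ ev-proj (⇓-unpair₁ y))
                  (⇓-eq (unpair₁ x) (unpair₁ y))

ker↪Columns : ∀ L → ker L ↪ Columns
ker↪Columns L = ker-↪ {L} {unpair₁} (λ x → pair (L x) x)
  (λ x y eq → proj₂ (pair-injective {L x} {x} {L y} {y} eq))
  (λ x y → mk⇔ (subst₂ _≡_ (sym (unpair₁-pair (L x) x)) (sym (unpair₁-pair (L y) y)))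
               (subst₂ _≡_ (unpair₁-pair (L x) x) (unpair₁-pair (L y) y)))

≅-refl : ∀ R → R ≅ R
≅-refl R = id , id , (λ _ → refl) , (λ _ → refl) , (λ _ _ → refl)

≅-sym : ∀ {R S} → R ≅ S → S ≅ R
≅-sym {R} {S} (f , g , gf , fg , preserves) = g , f , fg , gf ,
  λ x y → sym (trans (preserves (g x) (g y)) (cong₂ S (fg x) (fg y)))

≅-trans : ∀ {R S U} → R ≅ S → S ≅ U → R ≅ U
≅-trans (f , g , gf , fg , pres) (f′ , g′ , gf′ , fg′ , pres′) =
  f′ ∘ f , g ∘ g′ ,
  (λ x → trans (cong g (gf′ (f x))) (gf x)) ,
  (λ y → trans (cong f′ (fg (g′ y))) (fg′ y)) ,
  λ x y → trans (pres x y) (pres′ (f x) (f y))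

≅⇒↪ : ∀ {R S} → R ≅ S → R ↪ S
≅⇒↪ (f , g , gf , fg , pres) = f , (λ x y eq → trans (sym (gf x)) (trans (cong g eq) (gf y))) , pres

↪-trans : ∀ {R S U} → R ↪ S → S ↪ U → R ↪ U
↪-trans (f , f-inj , pres) (f′ , f′-inj , pres′) =
  f′ ∘ f , (λ x y eq → f-inj x y (f′-inj (f x) (f y) eq)) ,
  λ x y → trans (pres x y) (pres′ (f x) (f y))

≅⇒≈ᵇ : ∀ {R S} → R ≅ S → R ≈ᵇ S
≅⇒≈ᵇ {R} {S} iso = ≅⇒↪ {R} {S} iso , ≅⇒↪ {S} {R} (≅-sym {R} {S} iso)

≈ᵇ-trans : ∀ {R S U} → R ≈ᵇ S → S ≈ᵇ U → R ≈ᵇ U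
≈ᵇ-trans {R} {S} {U} (RS , SR) (SU , US) = ↪-trans {R} {S} {U} RS SU , ↪-trans {U} {S} {R} US SR

HasSingleton : Rel → Set
HasSingleton R = Σ ℕ λ s → ∀ m → R s m ≡ true → m ≡ s

NoSingleton : Rel → Set
NoSingleton R = ∀ m → Σ ℕ λ m′ → m′ ≢ m × R m m′ ≡ true

≅-HasSingleton : ∀ {R S} → R ≅ S → HasSingleton R → HasSingleton S
≅-HasSingleton {R} {S} (f , g , gf , fg , pres) (s , alone) = f s ,
  λ m related → trans (sym (fg m))
    (cong f (alone (g m) (trans (pres s (g m)) (trans (cong (S (f s)) (fg m)) related))))

HasSingleton-NoSingleton : ∀ {R} → HasSingleton R → NoSingleton R → ⊥
HasSingleton-NoSingleton (s , alone) partnered with partnered s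
... | m′ , m′≢s , related = m′≢s (alone m′ related)

-- Column 0 of the Cantor grid is labelled by l, every other column forms one class.
cell : (ℕ → ℕ) → ℕ → ℕ → ℕ
cell l zero    j = pair 0 (l j)
cell l (suc i) j = pair (suc i) 0

spliced : (ℕ → ℕ) → ℕ → ℕ
spliced l x = cell l (unpair₁ x) (unpair₂ x)

Spliced : (ℕ → ℕ) → Rel
Spliced l = ker (spliced l)

spliced-pair : ∀ l i j → spliced l (pair i j) ≡ cell l i j
spliced-pair l i j = cong₂ (cell l) (unpair₁-pair i j) (unpair₂-pair i j)

Columns↪Spliced : ∀ l → Columns ↪ Spliced l
Columns↪Spliced l = ker-↪ {unpair₁} {spliced l} shift shift-injective same-column
  where
    shift : ℕ → ℕ
    shift x = pair (suc (unpair₁ x)) (unpair₂ x)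

    shift-injective : ∀ x y → shift x ≡ shift y → x ≡ y
    shift-injective x y eq
      with pair-injective {suc (unpair₁ x)} {unpair₂ x} {suc (unpair₁ y)} {unpair₂ y} eq
    ... | same₁ , same₂ =
      trans (sym (pair-unpair x)) (trans (cong₂ pair (suc-injective same₁) same₂) (pair-unpair y))

    spliced-shift : ∀ x → spliced l (shift x) ≡ pair (suc (unpair₁ x)) 0
    spliced-shift x = spliced-pair l (suc (unpair₁ x)) (unpair₂ x)

    same-column : ∀ x y → unpair₁ x ≡ unpair₁ y ⇔ spliced l (shift x) ≡ spliced l (shift y)
    same-column x y = mk⇔
      (λ eq → trans (spliced-shift x) (trans (cong (λ i → pair (suc i) 0) eq) (sym (spliced-shift y))))
      (λ eq → suc-injective (proj₁ (pair-injective {suc (unpair₁ x)} {0} {suc (unpair₁ y)} {0}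
                (trans (sym (spliced-shift x)) (trans eq (spliced-shift y))))))

Spliced-≈ᵇ-Columns : ∀ l → Spliced l ≈ᵇ Columns
Spliced-≈ᵇ-Columns l = ker↪Columns (spliced l) , Columns↪Spliced l

Isolated : (ℕ → ℕ) → ℕ → Set
Isolated l s = ∀ n → l n ≡ l s → n ≡ s

Partner : (ℕ → ℕ) → ℕ → Set
Partner l m = Σ ℕ λ m′ → m′ ≢ m × l m′ ≡ l m

Isolated⇒HasSingleton : ∀ {l s} → Isolated l s → HasSingleton (Spliced l)
Isolated⇒HasSingleton {l} {s} isolated =
  pair 0 s , λ m related → alone m (ker-sound (spliced l) (pair 0 s) m related)
  where
    alone : ∀ m → spliced l (pair 0 s) ≡ spliced l m → m ≡ pair 0 s
    alone m eq with pair-surjective m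
    ... | i , j , refl = from-cell i (trans (sym (spliced-pair l 0 s)) (trans eq (spliced-pair l i j)))
      where
        from-cell : ∀ i → pair 0 (l s) ≡ cell l i j → pair i j ≡ pair 0 s
        from-cell zero    eq = cong (pair 0) (isolated j (sym (proj₂ (pair-injective {0} {l s} {0} {l j} eq))))
        from-cell (suc i) eq with () ← proj₁ (pair-injective {0} {l s} {suc i} {0} eq)

Partnered⇒NoSingleton : ∀ {l} → (∀ m → Partner l m) → NoSingleton (Spliced l)
Partnered⇒NoSingleton {l} partner m with pair-surjective m
... | zero , j , refl with partner j
...   | j′ , j′≢j , same = pair 0 j′ , j′≢j ∘ proj₂ ∘ pair-injective {0} {j′} {0} {j} ,
  ker-complete (spliced l) (pair 0 j) (pair 0 j′)
    (trans (spliced-pair l 0 j) (trans (cong (pair 0) (sym same)) (sym (spliced-pair l 0 j′))))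
Partnered⇒NoSingleton {l} partner m | suc i , j , refl = pair (suc i) (suc j) ,
  1+n≢n ∘ proj₂ ∘ pair-injective {suc i} {suc j} {suc i} {j} ,
  ker-complete (spliced l) (pair (suc i) j) (pair (suc i) (suc j))
    (trans (spliced-pair l (suc i) j) (sym (spliced-pair l (suc i) (suc j))))

Spliced-agree : ∀ {l l′ n} → (∀ m → m < n → l m ≡ l′ m) →
                ∀ x y → x < n → y < n → Spliced l x y ≡ Spliced l′ x y
Spliced-agree {l} {l′} {n} agree x y x<n y<n =
  cong₂ (λ a b → does (a ≟ b)) (spliced-agree x x<n) (spliced-agree y y<n)
  where
    cell-cong : ∀ i j → l j ≡ l′ j → cell l i j ≡ cell l′ i j
    cell-cong zero    j eq = cong (pair 0) eq
    cell-cong (suc i) j _  = refl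

    spliced-agree : ∀ x → x < n → spliced l x ≡ spliced l′ x
    spliced-agree x x<n =
      cell-cong (unpair₁ x) (unpair₂ x) (agree (unpair₂ x) (≤-<-trans (unpair₂-≤ x) x<n))

informant : Rel → ℕ → Datum
informant R n = (unpair₁ n , unpair₂ n) , R (unpair₁ n) (unpair₂ n)

informant-hit : ∀ R x y → InRange (informant R) ((x , y) , R x y)
informant-hit R x y = pair x y ,
  subst₂ (λ u v → ((u , v) , R u v) ≡ ((x , y) , R x y))
         (sym (unpair₁-pair x y)) (sym (unpair₂-pair x y)) refl

informant-value : ∀ R x y {b} → InRange (informant R) ((x , y) , b) → R x y ≡ b
informant-value R x y {b} (n , eq) =
  subst₂ (λ u v → R u v ≡ b) (cong (proj₁ ∘ proj₁) eq) (cong (proj₂ ∘ proj₁) eq) (cong proj₂ eq)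

informant-isInformant : ∀ R → IsInformant R (informant R)
informant-isInformant R = exactlyOne ,
  λ x y → mk⇔ (informant-value R x y)
                (λ eq → subst (λ b → InRange (informant R) ((x , y) , b)) eq (informant-hit R x y))
  where
    exactlyOne : ∀ x y →
      (InRange (informant R) ((x , y) , false) × ¬ InRange (informant R) ((x , y) , true)) ⊎
      (InRange (informant R) ((x , y) , true) × ¬ InRange (informant R) ((x , y) , false))
    exactlyOne x y with R x y | informant-hit R x y | informant-value R x y
    ... | false | hit | value = inj₁ (hit , λ wrong → case value wrong of λ ())
    ... | true  | hit | value = inj₂ (hit , λ wrong → case value wrong of λ ())

informant-prefix : ∀ R S n → (∀ x y → x < n → y < n → R x y ≡ S x y) →
                   informant R [ n ] ≡ informant S [ n ]
informant-prefix R S n agree = map-cong-local (applyUpTo⁺₁ id n λ {i} i<n →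
  cong ((unpair₁ i , unpair₂ i) ,_)
       (agree (unpair₁ i) (unpair₂ i) (≤-<-trans (unpair₁-≤ i) i<n) (≤-<-trans (unpair₂-≤ i) i<n)))

update : (ℕ → ℕ) → ℕ → ℕ → ℕ → ℕ
update l b v m = if does (m ≟ b) then v else l m

update-same : ∀ l b v → update l b v b ≡ v
update-same l b v rewrite dec-true (b ≟ b) refl = refl

update-other : ∀ l b v m → m ≢ b → update l b v m ≡ l m
update-other l b v m m≢b rewrite dec-false (m ≟ b) m≢b = refl

-- Label 0 marks the infinite class of blanks; label-≤ makes the label b given to a
-- fresh element b by isolate unused by any other element.
record Stage : Set where
  field
    label       : ℕ → ℕ
    bound       : ℕ
    label-≤     : ∀ m → label m ≤ m
    label-blank : ∀ m → bound < m → label m ≡ 0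
open Stage

blank : Stage
blank = record { label = λ _ → 0 ; bound = 0 ; label-≤ = λ _ → z≤n ; label-blank = λ _ _ → refl }

extend : (s : Stage) (b v : ℕ) → bound s < b → v ≤ b → Stage
extend s b v bound<b v≤b = record
  { label       = update (label s) b v
  ; bound       = b
  ; label-≤     = label-≤′
  ; label-blank = λ m b<m → trans (update-other (label s) b v m (≢-sym (<⇒≢ b<m)))
                                  (label-blank s m (<-trans bound<b b<m))
  }
  where
    label-≤′ : ∀ m → update (label s) b v m ≤ m
    label-≤′ m with m ≟ b
    ... | yes refl = ≤-trans (≤-reflexive (update-same (label s) b v)) v≤b
    ... | no m≢b   = subst (_≤ m) (sym (update-other (label s) b v m m≢b)) (label-≤ s m)

module _ (s : Stage) {b v : ℕ} (bound<b : bound s < b) (v≤b : v ≤ b) where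

  extend-agrees : ∀ m → m < b → label (extend s b v bound<b v≤b) m ≡ label s m
  extend-agrees m m<b = update-other (label s) b v m (<⇒≢ m<b)

  extend-keeps-partner : ∀ {m} → m ≢ b → label s m ≢ 0 → Partner (label s) m →
                         Partner (label (extend s b v bound<b v≤b)) m
  extend-keeps-partner {m} m≢b nonzero (m′ , m′≢m , same) = m′ , m′≢m ,
    trans (update-other (label s) b v m′ m′≢b) (trans same (sym (update-other (label s) b v m m≢b)))
    where
      m′≢b : m′ ≢ b
      m′≢b refl = nonzero (trans (sym same) (label-blank s b bound<b))

isolate : (s : Stage) (b : ℕ) → bound s < b → Stage
isolate s b bound<b = extend s b b bound<b ≤-refl

pairUp : (s : Stage) (b : ℕ) → bound s < b → Stage
pairUp s b bound<b = extend s b (bound s) bound<b (<⇒≤ bound<b)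

Paired : Stage → Set
Paired s = ∀ m → label s m ≢ 0 → Partner (label s) m

record Lonely (s : Stage) : Set where
  field
    self-labelled  : label s (bound s) ≡ bound s
    bound-positive : 0 < bound s
    partnered      : ∀ m → m ≢ bound s → label s m ≢ 0 → Partner (label s) m

blank-paired : Paired blank
blank-paired m nonzero with () ← nonzero refl

isolate-lonely : ∀ s b (bound<b : bound s < b) → Paired s → Lonely (isolate s b bound<b)
isolate-lonely s b bound<b paired = record
  { self-labelled  = update-same (label s) b b
  ; bound-positive = ≤-<-trans z≤n bound<b
  ; partnered      = λ m m≢b nonzero →
      let nonzero′ = nonzero ∘ trans (update-other (label s) b b m m≢b)
      in extend-keeps-partner s bound<b ≤-refl m≢b nonzero′ (paired m nonzero′)
  }

pairUp-paired : ∀ s b (bound<b : bound s < b) → Lonely s → Paired (pairUp s b bound<b)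
pairUp-paired s b bound<b lonely m nonzero with m ≟ b | m ≟ bound s
... | yes refl | _ = bound s , <⇒≢ bound<b ,
  trans (extend-agrees s bound<b (<⇒≤ bound<b) (bound s) bound<b)
        (trans self-labelled (sym (update-same (label s) b (bound s))))
  where open Lonely lonely
... | no m≢b | yes refl = b , ≢-sym m≢b ,
  trans (update-same (label s) b (bound s))
        (sym (trans (extend-agrees s bound<b (<⇒≤ bound<b) (bound s) bound<b) self-labelled))
  where open Lonely lonely
... | no m≢b | no m≢bound =
  let nonzero′ = nonzero ∘ trans (update-other (label s) b (bound s) m m≢b)
  in extend-keeps-partner s bound<b (<⇒≤ bound<b) m≢b nonzero′
       (Lonely.partnered lonely m m≢bound nonzero′)

Lonely⇒Isolated : ∀ {s} → Lonely s → Isolated (label s) (bound s)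
Lonely⇒Isolated {s} lonely n same with <-cmp n (bound s)
... | tri< n<bound _ _ =
  contradiction (trans same self-labelled) (<⇒≢ (≤-<-trans (label-≤ s n) n<bound))
  where open Lonely lonely
... | tri≈ _ n≡bound _ = n≡bound
... | tri> _ _ bound<n =
  contradiction (trans (sym (label-blank s n bound<n)) (trans same self-labelled)) (<⇒≢ bound-positive)
  where open Lonely lonely

Paired⇒Partnered : ∀ {s} → Paired s → ∀ m → Partner (label s) m
Paired⇒Partnered {s} paired m with label s m ≟ 0
... | no nonzero = paired m nonzero
... | yes blank-m = suc (bound s + m) , ≢-sym (<⇒≢ (s≤s (m≤n+m m (bound s)))) ,
  trans (label-blank s _ (s≤s (m≤m+n (bound s) m))) (sym blank-m)

module Limit (f : ℕ → ℕ → ℕ) (cut : ℕ → ℕ) (cut-< : ∀ k → cut k < cut (suc k))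
             (stable : ∀ k m → m ≤ cut k → f (suc k) m ≡ f k m) where

  cut-≥ : ∀ k → k ≤ cut k
  cut-≥ zero    = z≤n
  cut-≥ (suc k) = ≤-<-trans (cut-≥ k) (cut-< k)

  cut-mono : ∀ {k j} → k ≤′ j → cut k ≤ cut j
  cut-mono ≤′-refl         = ≤-refl
  cut-mono (≤′-step k≤′j) = ≤-trans (cut-mono k≤′j) (<⇒≤ (cut-< _))

  stable-from : ∀ {k j} m → k ≤′ j → m ≤ cut k → f j m ≡ f k m
  stable-from m ≤′-refl                _     = refl
  stable-from m (≤′-step {j} k≤′j) m≤cut =
    trans (stable j m (≤-trans m≤cut (cut-mono k≤′j))) (stable-from m k≤′j m≤cut)

  limit : ℕ → ℕ
  limit m = f m m

  limit-agrees : ∀ k m → m ≤ cut k → limit m ≡ f k m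
  limit-agrees k m m≤cut with ≤-total m k
  ... | inj₁ m≤k = sym (stable-from m (≤⇒≤′ m≤k) (cut-≥ m))
  ... | inj₂ k≤m = stable-from m (≤⇒≤′ k≤m) m≤cut

module Locking (E : ℕ → Rel) (M : Learner)
  (learns : ∀ l → Σ ℕ λ e →
              (Σ ℕ λ N → ∀ n → N ≤ n → M (informant (Spliced l) [ n ]) ≡ just e) × (Spliced l ≅ E e))
  where

  conjecture : (ℕ → ℕ) → ℕ
  conjecture l = proj₁ (learns l)

  settle : (ℕ → ℕ) → ℕ
  settle l = proj₁ (proj₁ (proj₂ (learns l)))

  settles : ∀ l n → settle l ≤ n → M (informant (Spliced l) [ n ]) ≡ just (conjecture l)
  settles l = proj₂ (proj₁ (proj₂ (learns l)))

  correct : ∀ l → Spliced l ≅ E (conjecture l)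
  correct l = proj₂ (proj₂ (learns l))

  agreeing-≅ : ∀ l l′ n → settle l ≤ n → settle l′ ≤ n → (∀ m → m < n → l m ≡ l′ m) →
               Spliced l ≅ Spliced l′
  agreeing-≅ l l′ n l-settled l′-settled agree =
    ≅-trans {Spliced l} {E (conjecture l)} {Spliced l′} (correct l)
      (subst (λ e → E e ≅ Spliced l′) (sym same-conjecture)
             (≅-sym {Spliced l′} {E (conjecture l′)} (correct l′)))
    where
      open ≡-Reasoning
      same-conjecture : conjecture l ≡ conjecture l′
      same-conjecture = just-injective (begin
        just (conjecture l)                ≡⟨ sym (settles l n l-settled) ⟩
        M (informant (Spliced l) [ n ])
          ≡⟨ cong M (informant-prefix (Spliced l) (Spliced l′) n (Spliced-agree agree)) ⟩
        M (informant (Spliced l′) [ n ])   ≡⟨ settles l′ n l′-settled ⟩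
        just (conjecture l′)               ∎)

  nextBound : Stage → ℕ
  nextBound s = suc (bound s + settle (label s))

  bound<nextBound : ∀ s → bound s < nextBound s
  bound<nextBound s = s≤s (m≤m+n (bound s) (settle (label s)))

  settle≤nextBound : ∀ s → settle (label s) ≤ nextBound s
  settle≤nextBound s = ≤-trans (m≤n+m (settle (label s)) (bound s)) (n≤1+n _)

  paired : ℕ → Stage
  lonely : ℕ → Stage

  paired zero    = blank
  paired (suc k) = pairUp (lonely k) (nextBound (lonely k)) (bound<nextBound (lonely k))

  lonely k = isolate (paired k) (nextBound (paired k)) (bound<nextBound (paired k))

  paired-Paired : ∀ k → Paired (paired k)
  lonely-Lonely : ∀ k → Lonely (lonely k)

  paired-Paired zero    = blank-paired
  paired-Paired (suc k) = pairUp-paired (lonely k) _ (bound<nextBound (lonely k)) (lonely-Lonely k)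

  lonely-Lonely k = isolate-lonely (paired k) _ (bound<nextBound (paired k)) (paired-Paired k)

  lonely-agrees : ∀ k m → m < bound (lonely k) → label (lonely k) m ≡ label (paired k) m
  lonely-agrees k = extend-agrees (paired k) (bound<nextBound (paired k)) ≤-refl

  paired-agrees : ∀ k m → m < bound (paired (suc k)) → label (paired (suc k)) m ≡ label (lonely k) m
  paired-agrees k =
    extend-agrees (lonely k) (bound<nextBound (lonely k)) (<⇒≤ (bound<nextBound (lonely k)))

  paired-grows : ∀ k → bound (paired k) < bound (paired (suc k))
  paired-grows k = <-trans (bound<nextBound (paired k)) (bound<nextBound (lonely k))

  paired-stable : ∀ k m → m ≤ bound (paired k) → label (paired (suc k)) m ≡ label (paired k) m
  paired-stable k m m≤bound =
    trans (paired-agrees k m (≤-<-trans m≤bound (paired-grows k)))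
          (lonely-agrees k m (≤-<-trans m≤bound (bound<nextBound (paired k))))

  open Limit (λ k → label (paired k)) (λ k → bound (paired k)) paired-grows paired-stable

  impossible : ⊥
  impossible = HasSingleton-NoSingleton {Spliced (label (paired k))}
    (≅-HasSingleton {Spliced (label (lonely k))} {Spliced (label (paired k))} lonely≅paired
      (Isolated⇒HasSingleton (Lonely⇒Isolated (lonely-Lonely k))))
    (Partnered⇒NoSingleton {label (paired k)} (Paired⇒Partnered {paired k} (paired-Paired k)))
    where
      k : ℕ
      k = settle limit

      lonely-agrees-limit : ∀ m → m < bound (paired (suc k)) → label (lonely k) m ≡ limit m
      lonely-agrees-limit m m<bound =
        sym (trans (limit-agrees (suc k) m (<⇒≤ m<bound)) (paired-agrees k m m<bound))

      paired-agrees-limit : ∀ m → m < bound (lonely k) → label (paired k) m ≡ limit m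
      paired-agrees-limit m m<bound =
        trans (sym (lonely-agrees k m m<bound))
              (lonely-agrees-limit m (<-trans m<bound (bound<nextBound (lonely k))))

      k≤bound : k ≤ bound (lonely k)
      k≤bound = ≤-trans (cut-≥ k) (<⇒≤ (bound<nextBound (paired k)))

      paired≅limit : Spliced (label (paired k)) ≅ Spliced limit
      paired≅limit = agreeing-≅ _ limit _ (settle≤nextBound (paired k)) k≤bound paired-agrees-limit

      lonely≅limit : Spliced (label (lonely k)) ≅ Spliced limit
      lonely≅limit = agreeing-≅ _ limit _ (settle≤nextBound (lonely k))
        (≤-trans k≤bound (<⇒≤ (bound<nextBound (lonely k)))) lonely-agrees-limit

      lonely≅paired : Spliced (label (lonely k)) ≅ Spliced (label (paired k))
      lonely≅paired =
        ≅-trans {Spliced (label (lonely k))} {Spliced limit} {Spliced (label (paired k))}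
          lonely≅limit (≅-sym {Spliced (label (paired k))} {Spliced limit} paired≅limit)

InfExLearnable-mono : ∀ {E} {_∼_ _∼′_ : Rel → Rel → Set} {𝔄} → (∀ {R S} → R ∼ S → R ∼′ S) →
                      InfExLearnable E _∼_ 𝔄 → InfExLearnable E _∼′_ 𝔄
InfExLearnable-mono weaken (M , learns) = M , λ A A∈𝔄 A* A*≅A I informs →
  let (e , converges , similar) = learns A A∈𝔄 A* A*≅A I informs in e , converges , weaken similar

≈ᵇ-class : Rel → EqStr → Set
≈ᵇ-class R A = rel A ≈ᵇ R

≈ᵇ-class-≈ᵇ-learnable : ∀ E R e → R ≅ E e → InfExLearnable E _≈ᵇ_ (≈ᵇ-class R)
≈ᵇ-class-≈ᵇ-learnable E R e R≅Ee = (λ _ → just e) , λ A A≈R A* A*≅A I _ → e , (0 , λ _ _ → refl) ,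
  ≈ᵇ-trans {rel A*} {rel A} {E e} (≅⇒≈ᵇ {rel A*} {rel A} A*≅A)
    (≈ᵇ-trans {rel A} {R} {E e} A≈R (≅⇒≈ᵇ {R} {E e} R≅Ee))

splicedStr : (ℕ → ℕ) → EqStr
splicedStr l = record { rel = Spliced l ; isEquiv = ker-isEquivRel (spliced l) }

≈ᵇ-class-Columns-not-≅-learnable : ∀ E → ¬ InfExLearnable E _≅_ (≈ᵇ-class Columns)
≈ᵇ-class-Columns-not-≅-learnable E (M , learns) = Locking.impossible E M λ l →
  learns (splicedStr l) (Spliced-≈ᵇ-Columns l) (splicedStr l) (≅-refl (Spliced l))
         (informant (Spliced l)) (informant-isInformant (Spliced l))

mainTheorem5 : (E : ℕ → Rel) → ComputableSeq E → (∀ i → IsEquivRel (E i))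
    → (∀ (R : Rel) → IsEquivRel R → ComputableRel R → Σ ℕ λ i → R ≅ E i)
    → ((𝔄 : EqStr → Set) → InfExLearnable E _≅_ 𝔄 → InfExLearnable E _≈ᵇ_ 𝔄)
      × (Σ (EqStr → Set) λ 𝔄 → InfExLearnable E _≈ᵇ_ 𝔄 × ¬ InfExLearnable E _≅_ 𝔄)
mainTheorem5 E _ _ enumerates =
  (λ 𝔄 → InfExLearnable-mono (λ {R} {S} → ≅⇒≈ᵇ {R} {S})) ,
  ≈ᵇ-class Columns ,
  ≈ᵇ-class-≈ᵇ-learnable E Columns (proj₁ Columns-index) (proj₂ Columns-index) ,
  ≈ᵇ-class-Columns-not-≅-learnable E
  where
    Columns-index : Σ ℕ λ i → Columns ≅ E i
    Columns-index = enumerates Columns (ker-isEquivRel unpair₁) Columns-computable
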